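{- For the elementary cellular automaton $F_{78}$ and every nonempty finite word $u\in\{0,1\}^*$, $D(\textsc{SInv}_{F_{78},u,n})\in O(1)$ as $n\to\infty$.
   Context: The ECA with Wolfram number $N$ is $F_N:\{0,1\}^{\mathbb{Z}}\to\{0,1\}^{\mathbb{Z}}$, $(F_N(x))_i=f_N(x_{i-1},x_i,x_{i+1})$, where $f_N(a,b,c)$ is the bit of index $4a+2b+c$ of $N$ in binary. For a nonempty word $u$, $p_u\in\{0,1\}^{\mathbb{Z}}$ is $(p_u)_i=u_{i\bmod |u|}$; for a finite word $x$, $p_u[x]$ equals $x$ on positions $\{0,\dots,|x|-1\}$ and $p_u$ elsewhere. $\textsc{SInv}_{F,u,n}:\{0,1\}^n\to\{0,1\}$ maps $x$ to $1$ iff there is an integer $w$ such that for every $t\ge 0$ the set of positions where $F^t(p_u)$ and $F^t(p_u[x])$ differ is contained in an interval of length $w$. For finite sets $X,Y,Z$ and $g:X\times Y\to Z$, $D(g)$ is the minimal depth of a deterministic two-party communication protocol tree computing $g$ (Alice knows $x$, Bob knows $y$; internal nodes are labelled by a function of $x$ alone or of $y$ alone to $\{\mathrm{l},\mathrm{r}\}$, leaves by outputs). For $g:\{0,1\}^m\to Z$, $D(g)=\max_{0\le i\le m} D(g_i)$ with $g_i(x,y)=g(xy)$ for $x\in\{0,1\}^i$, $y\in\{0,1\}^{m-i}$. -}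

module Defs where

open import Data.Bool using (Bool; true; false; if_then_else_)
open import Data.Nat as ℕ using (ℕ; zero; suc; _+_; _*_; _^_; _<?_)
open import Data.Nat.DivMod using (_/_; _%_)
open import Data.Nat.Properties using (m^n≢0)
open import Data.Integer as ℤ using (ℤ; +_; -[1+_])
open import Data.Integer.DivMod using (_%ℕ_; n%ℕd<d)
open import Data.Fin using (Fin; fromℕ<)
open import Data.Vec using (Vec; lookup)
open import Data.Product using (Σ; ∃; _×_)
open import Relation.Nullary using (¬_; yes; no)
open import Relation.Binary.PropositionalEquality using (_≡_)

Config : Set
Config = ℤ → Bool

toℕ𝔹 : Bool → ℕ
toℕ𝔹 false = 0
toℕ𝔹 true  = 1

bit : ℕ → ℕ → Bool
bit N k with (N / (2 ^ k)) {{m^n≢0 2 k}} % 2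
... | zero = false
... | suc _ = true

localRule : ℕ → Bool → Bool → Bool → Bool
localRule N a b c = bit N (4 * toℕ𝔹 a + 2 * toℕ𝔹 b + toℕ𝔹 c)

ECA : ℕ → Config → Config
ECA N x i = localRule N (x (i ℤ.- ℤ.+ 1)) (x i) (x (i ℤ.+ ℤ.+ 1))

iter : (Config → Config) → ℕ → Config → Config
iter F zero x = x
iter F (suc t) x = F (iter F t x)

periodic : ∀ {k} → Vec Bool (suc k) → Config
periodic {k} u i = lookup u (fromℕ< (n%ℕd<d i (suc k)))

patch : ∀ {k n} → Vec Bool (suc k) → Vec Bool n → Config
patch {n = n} u x (+ m) with m <? n
... | yes m<n = lookup x (fromℕ< m<n)
... | no  _   = periodic u (+ m)
patch u x -[1+ m ] = periodic u -[1+ m ]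

SInv : ℕ → ∀ {k n} → Vec Bool (suc k) → Vec Bool n → Set
SInv N u x =
  ∃ λ (w : ℕ) → ∀ (t : ℕ) → ∃ λ (a : ℤ) → ∀ (j : ℤ) →
    ¬ (iter (ECA N) t (periodic u) j ≡ iter (ECA N) t (patch u x) j) →
    (a ℤ.≤ j) × (j ℤ.< a ℤ.+ + w)

data Protocol (X Y Z : Set) : Set where
  leaf  : Z → Protocol X Y Z
  alice : (X → Bool) → Protocol X Y Z → Protocol X Y Z → Protocol X Y Z
  bob   : (Y → Bool) → Protocol X Y Z → Protocol X Y Z → Protocol X Y Z
  -- convention: false = l (left subtree), true = r (right subtree)

depth : ∀ {X Y Z} → Protocol X Y Z → ℕ
depth (leaf _) = 0
depth (alice _ l r) = suc (depth l ℕ.⊔ depth r)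
depth (bob _ l r) = suc (depth l ℕ.⊔ depth r)

run : ∀ {X Y Z} → Protocol X Y Z → X → Y → Z
run (leaf z) x y = z
run (alice f l r) x y = if f x then run r x y else run l x y
run (bob g l r) x y = if g y then run r x y else run l x y

Computes : ∀ {X Y} → Protocol X Y Bool → (X → Y → Set) → Set
Computes π P = ∀ x y → (run π x y ≡ true → P x y) × (P x y → run π x y ≡ true)

-- A wall, i.e. the pattern 10 at
-- positions (q, q+1), is fixed forever and shields each side of it from the other.  If u
-- is not constant, p_u has walls on both sides of the patched window, so p_u and p_u[x]
-- only ever differ between two fixed walls and SInv is identically true.  If u is the
-- constant c, then p_u[x] = p_u when x = c^n.  Otherwise, one step later the background
-- is 0^ℤ (F maps both constant configurations to 0^ℤ) and there is a leftmost 1 with a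
-- wall to its right; the leftmost 1 drifts left one cell per step while the wall stays
-- put, so the difference set is unbounded.  Hence SInv(xy) holds iff x = c^i and y = c^j,
-- which two bits of communication decide.
module Submission where

open import Defs
open import Data.Bool using (Bool; true; false; not; _∧_; _∨_; _≟_)
open import Data.Bool.Properties using (¬-not; not-¬)
open import Data.Empty using (⊥-elim)
open import Data.Fin using (Fin; zero; toℕ)
open import Data.Fin.Properties using (toℕ<n; fromℕ<-cong; fromℕ<-toℕ; all?; ¬∀⟶∃¬)
open import Data.Integer as ℤ
  using (ℤ; +_; -[1+_]; _+_; _-_; _⊖_; _%ℕ_; _≤_; _<_; +≤+; -≤+)
import Data.Integer.Properties as ℤP
open import Data.Integer.Tactic.RingSolver using (solve-∀)
open import Data.Nat as ℕ using (ℕ; zero; suc; _∸_; NonZero; z≤n; s≤s)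
import Data.Nat.Properties as ℕP
open import Data.Nat.DivMod using (_%_; [m+n]%n≡m%n; m<n⇒m%n≡m; n%n≡0)
open import Data.Product using (Σ; ∃; _×_; _,_; proj₁; proj₂; uncurry)
open import Data.Sum using (_⊎_; inj₁; inj₂; [_,_]′)
open import Data.Vec using (Vec; lookup; _++_)
open import Data.Vec.Relation.Unary.All using (All) renaming (all? to allᵥ?)
open import Data.Vec.Relation.Unary.All.Properties using (lookup⁺; lookup⁻; ++⁺; ++⁻)
open import Function using (_∘_; case_of_)
open import Function.Bundles using (_⇔_; mk⇔; Equivalence)
open import Relation.Nullary using (¬_; yes; no; does)
open import Relation.Nullary.Decidable using (decidable-stable)
open import Relation.Unary using (Decidable)
open import Relation.Binary.Definitions using (tri<; tri≈; tri>)
open import Relation.Binary.PropositionalEquality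

rule78 : Bool → Bool → Bool → Bool
rule78 false b c = b ∨ c
rule78 true  b c = b ∧ not c

localRule-78 : ∀ a b c → localRule 78 a b c ≡ rule78 a b c
localRule-78 false false false = refl
localRule-78 false false true  = refl
localRule-78 false true  false = refl
localRule-78 false true  true  = refl
localRule-78 true  false false = refl
localRule-78 true  false true  = refl
localRule-78 true  true  false = refl
localRule-78 true  true  true  = refl

rule78-wall : ∀ a → rule78 a true false ≡ true
rule78-wall false = refl
rule78-wall true  = refl

rule78-diagonal : ∀ b → rule78 b b b ≡ false
rule78-diagonal false = refl
rule78-diagonal true  = refl

F : Config → Config
F = ECA 78

left right : ℤ → ℤ
left  i = i - + 1
right i = i + + 1

left-right : ∀ i → left (right i) ≡ i
left-right = lemma
  where
  lemma : ∀ i → (i + + 1) - + 1 ≡ i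
  lemma = solve-∀

right-left : ∀ i → right (left i) ≡ i
right-left = lemma
  where
  lemma : ∀ i → (i - + 1) + + 1 ≡ i
  lemma = solve-∀

i<right : ∀ i → i < right i
i<right i = ℤP.suc[i]≤j⇒i<j (ℤP.≤-reflexive (ℤP.+-comm (+ 1) i))

<⇒right≤ : ∀ {i j} → i < j → right i ≤ j
<⇒right≤ {i} i<j = subst (_≤ _) (ℤP.+-comm (+ 1) i) (ℤP.i<j⇒suc[i]≤j i<j)

left<i : ∀ i → left i < i
left<i i = subst (left i <_) (right-left i) (i<right (left i))

<⇒≤left : ∀ {i j} → j < i → j ≤ left i
<⇒≤left {i} j<i = subst (_≤ left i) (left-right _) (ℤP.+-monoˡ-≤ -[1+ 0 ] (<⇒right≤ j<i))

<right⇒≤ : ∀ {i j} → j < right i → j ≤ i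
<right⇒≤ {i} j<i+1 = subst (_ ≤_) (left-right i) (<⇒≤left j<i+1)

i≤right : ∀ i → i ≤ right i
i≤right i = ℤP.<⇒≤ (i<right i)

≤⇒≤right : ∀ {i j} → i ≤ j → i ≤ right j
≤⇒≤right {j = j} i≤j = ℤP.≤-trans i≤j (i≤right j)

right-mono-≤ : ∀ {i j} → i ≤ j → right i ≤ right j
right-mono-≤ = ℤP.+-monoˡ-≤ (+ 1)

≤⇒≡⊎< : ∀ {i j} → i ≤ j → i ≡ j ⊎ i < j
≤⇒≡⊎< {i} {j} i≤j with i ℤ.≟ j
... | yes i≡j = inj₁ i≡j
... | no  i≢j = inj₂ (ℤP.≤∧≢⇒< i≤j i≢j)

+∣-∣ : ∀ {i j} → i ≤ j → i + + ℤ.∣ i - j ∣ ≡ j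
+∣-∣ {i} {j} i≤j = trans (cong (λ k → i + k) (ℤP.∣-∣-≤ i≤j)) (lemma i j)
  where
  lemma : ∀ i j → i + (j - i) ≡ j
  lemma = solve-∀

F-eval : ∀ z i {a b c} → z (left i) ≡ a → z i ≡ b → z (right i) ≡ c → F z i ≡ rule78 a b c
F-eval z i refl refl refl = localRule-78 (z (left i)) (z i) (z (right i))

F-local : ∀ z z′ i →
  z (left i) ≡ z′ (left i) → z i ≡ z′ i → z (right i) ≡ z′ (right i) → F z i ≡ F z′ i
F-local z z′ i p q r = trans (F-eval z i p q r) (sym (F-eval z′ i refl refl refl))

F-constant : ∀ z {b} → (∀ j → z j ≡ b) → ∀ j → F z j ≡ false
F-constant z {b} z≡b j =
  trans (F-eval z j (z≡b (left j)) (z≡b j) (z≡b (right j))) (rule78-diagonal b)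

iter-+ : ∀ (G : Config → Config) t o z → iter G (t ℕ.+ o) z ≡ iter G t (iter G o z)
iter-+ G zero    o z = refl
iter-+ G (suc t) o z = cong G (iter-+ G t o z)

iter-preserves : ∀ {G} (P : Config → Set) → (∀ z → P z → P (G z)) →
  ∀ t {z} → P z → P (iter G t z)
iter-preserves P step zero    p = p
iter-preserves P step (suc t) p = step _ (iter-preserves P step t p)

iter-preserves₂ : ∀ {G} (R : Config → Config → Set) → (∀ x y → R x y → R (G x) (G y)) →
  ∀ t {x y} → R x y → R (iter G t x) (iter G t y)
iter-preserves₂ R step zero    r = r
iter-preserves₂ R step (suc t) r = step _ _ (iter-preserves₂ R step t r)

iter-cong : ∀ {x y} → (∀ j → x j ≡ y j) → ∀ t j → iter F t x j ≡ iter F t y j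
iter-cong x≡y t = iter-preserves₂ (λ x y → ∀ j → x j ≡ y j)
  (λ x y x≡y j → F-local x y j (x≡y _) (x≡y _) (x≡y _)) t x≡y

BoundedDifference : Config → Config → Set
BoundedDifference x y =
  ∃ λ (w : ℕ) → ∀ (t : ℕ) → ∃ λ (a : ℤ) → ∀ (j : ℤ) →
    iter F t x j ≢ iter F t y j → a ≤ j × j < a + + w

record Wall (z : Config) (q : ℤ) : Set where
  constructor mkWall
  field
    high : z q ≡ true
    low  : z (right q) ≡ false

F-wall : ∀ z q → Wall z q → Wall (F z) q
F-wall z q (mkWall zq zq′) = mkWall
  (trans (F-eval z q refl zq zq′) (rule78-wall (z (left q))))
  (F-eval z (right q) (trans (cong z (left-right q)) zq) zq′ refl)

first-change : ∀ (z : Config) {b p q} → p ≤ q → z p ≡ b → z q ≢ b →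
  ∃ λ l → p < l × l ≤ q × z l ≢ b × (∀ j → p ≤ j → j < l → z j ≡ b)
first-change z {b} {p} {q} p≤q zp zq = scan ℤ.∣ p - q ∣ (+∣-∣ p≤q) zp
  where
  scan : ∀ d {p} → p + + d ≡ q → z p ≡ b →
    ∃ λ l → p < l × l ≤ q × z l ≢ b × (∀ j → p ≤ j → j < l → z j ≡ b)
  scan zero {p} p+0≡q zp =
    ⊥-elim (zq (subst (λ i → z i ≡ b) (trans (sym (ℤP.+-identityʳ p)) p+0≡q) zp))
  scan (suc d) {p} p+d≡q zp with z (right p) ≟ b
  ... | no z₁≢b = right p , i<right p ,
        subst (right p ≤_) p+d≡q (ℤP.+-monoʳ-≤ p (+≤+ (s≤s z≤n))) , z₁≢b ,
        λ j p≤j j<p+1 → subst (λ i → z i ≡ b) (ℤP.≤-antisym p≤j (<right⇒≤ j<p+1)) zp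
  ... | yes z₁≡b with scan d (trans (ℤP.+-assoc p (+ 1) (+ d)) p+d≡q) z₁≡b
  ...   | l , p+1<l , l≤q , zl≢b , prefix = l , ℤP.<-trans (i<right p) p+1<l , l≤q , zl≢b ,
          λ j p≤j j<l →
            [ (λ { refl → zp }) , (λ p<j → prefix j (<⇒right≤ p<j) j<l) ]′ (≤⇒≡⊎< p≤j)

wall-after : ∀ (z : Config) {p q} → p ≤ q → z p ≡ true → z q ≡ false →
  ∃ λ w → p ≤ w × Wall z w
wall-after z p≤q zp zq with first-change z p≤q zp (not-¬ zq)
... | l , p<l , _ , zl≢1 , ones = left l , <⇒≤left p<l ,
      mkWall (ones (left l) (<⇒≤left p<l) (left<i l))
             (trans (cong z (right-left l)) (¬-not zl≢1))

first-after-prefix : ∀ (z : Config) {b p q} →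
  (∀ j → j ≤ p → z j ≡ b) → p ≤ q → z q ≢ b →
  ∃ λ l → l ≤ q × z l ≢ b × (∀ j → j < l → z j ≡ b)
first-after-prefix z {b} {p} before p≤q zq with first-change z p≤q (before p ℤP.≤-refl) zq
... | l , _ , l≤q , zl≢b , prefix = l , l≤q , zl≢b , below-l
  where
  below-l : ∀ j → j < l → z j ≡ b
  below-l j j<l with j ℤP.≤? p
  ... | yes j≤p = before j j≤p
  ... | no  j≰p = prefix j (ℤP.<⇒≤ (ℤP.≰⇒> j≰p)) j<l

-- Walls

record Sandwich (x y : Config) (l r : ℤ) : Set where
  field
    wallˡ  : Wall x l
    wallʳ  : Wall x r
    agreeˡ : ∀ j → j ≤ right l → x j ≡ y j
    agreeʳ : ∀ j → r ≤ j → x j ≡ y j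

F-sandwich : ∀ x y {l r} → Sandwich x y l r → Sandwich (F x) (F y) l r
F-sandwich x y {l} {r} s = record
  { wallˡ = F-wall x l wallˡ ; wallʳ = F-wall x r wallʳ ; agreeˡ = agreeˡ′ ; agreeʳ = agreeʳ′ }
  where
  open Sandwich s
  wall-y : ∀ {q} → Wall x q → x q ≡ y q → x (right q) ≡ y (right q) → Wall y q
  wall-y (mkWall xq xq′) e e′ = mkWall (trans (sym e) xq) (trans (sym e′) xq′)
  wallˡ-y : Wall y l
  wallˡ-y = wall-y wallˡ (agreeˡ l (i≤right l)) (agreeˡ (right l) ℤP.≤-refl)
  wallʳ-y : Wall y r
  wallʳ-y = wall-y wallʳ (agreeʳ r ℤP.≤-refl) (agreeʳ (right r) (i≤right r))
  agreeˡ′ : ∀ j → j ≤ right l → F x j ≡ F y j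
  agreeˡ′ j j≤l+1 with ≤⇒≡⊎< j≤l+1
  ... | inj₁ refl = trans (Wall.low (F-wall x l wallˡ)) (sym (Wall.low (F-wall y l wallˡ-y)))
  ... | inj₂ j<l+1 = F-local x y j (agreeˡ (left j) (ℤP.≤-trans (ℤP.<⇒≤ (left<i j)) j≤l+1))
                                     (agreeˡ j j≤l+1)
                                     (agreeˡ (right j) (right-mono-≤ (<right⇒≤ {l} j<l+1)))
  agreeʳ′ : ∀ j → r ≤ j → F x j ≡ F y j
  agreeʳ′ j r≤j with ≤⇒≡⊎< r≤j
  ... | inj₁ refl = trans (Wall.high (F-wall x r wallʳ)) (sym (Wall.high (F-wall y r wallʳ-y)))
  ... | inj₂ r<j = F-local x y j (agreeʳ (left j) (<⇒≤left r<j)) (agreeʳ j r≤j)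
                                   (agreeʳ (right j) (≤⇒≤right r≤j))

sandwich⇒bounded : ∀ x y {l r} → Sandwich x y l r → BoundedDifference x y
sandwich⇒bounded x y {l} {r} s =
  ℤ.∣ l - r ∣ , λ t → l , λ j differs → within (iterₛ t) j differs
  where
  iterₛ : ∀ t → Sandwich (iter F t x) (iter F t y) l r
  iterₛ t = iter-preserves₂ (λ x y → Sandwich x y l r) (λ x y → F-sandwich x y) t s
  within : ∀ {x′ y′} → Sandwich x′ y′ l r → ∀ j → x′ j ≢ y′ j →
    l ≤ j × j < l + + ℤ.∣ l - r ∣
  within s′ j differs =
    ℤP.<⇒≤ l<j , subst (j <_) (sym (+∣-∣ (ℤP.<⇒≤ (ℤP.<-trans l<j j<r)))) j<r
    where
    open Sandwich s′
    l<j : l < j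
    l<j = ℤP.≰⇒> (λ j≤l → differs (agreeˡ j (≤⇒≤right j≤l)))
    j<r : j < r
    j<r = ℤP.≰⇒> (λ r≤j → differs (agreeʳ j r≤j))

-- Escaping fronts

record Front (z : Config) (l r : ℤ) : Set where
  field
    vacant  : ∀ j → j < l → z j ≡ false
    leading : z l ≡ true
    wall    : Wall z r
    l≤r     : l ≤ r

prefix-front : ∀ (z : Config) {l q} → (∀ j → j < l → z j ≡ false) → z l ≡ true →
  z q ≡ false → l ≤ q → ∃ (Front z l)
prefix-front z vacant zl zq l≤q =
  let r , l≤r , wall = wall-after z l≤q zl zq
  in  r , record { vacant = vacant ; leading = zl ; wall = wall ; l≤r = l≤r }

F-front : ∀ z {l r} → Front z l r → Front (F z) (left l) r
F-front z {l} {r} front = record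
  { vacant  = λ j j<l-1 → F-eval z j (vacant (left j) (ℤP.<-trans (left<i j) (j<l j<l-1)))
                                     (vacant j (j<l j<l-1))
                                     (vacant (right j) (ℤP.≤-<-trans (<⇒right≤ j<l-1) (left<i l)))
  ; leading = F-eval z (left l) (vacant (left (left l)) (ℤP.<-trans (left<i (left l)) (left<i l)))
                                (vacant (left l) (left<i l))
                                (trans (cong z (right-left l)) leading)
  ; wall    = F-wall z r wall
  ; l≤r     = ℤP.≤-trans (ℤP.<⇒≤ (left<i l)) l≤r
  }
  where
  open Front front
  j<l : ∀ {j} → j < left l → j < l
  j<l j<l-1 = ℤP.<-trans j<l-1 (left<i l)

front-iter : ∀ {z l r} → Front z l r → ∀ t → Front (iter F t z) (l - + t) r
front-iter {z} {l} {r} front zero = subst (λ l′ → Front z l′ r) (sym (ℤP.+-identityʳ l)) front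
front-iter {z} {l} {r} front (suc t) =
  subst (λ l′ → Front (iter F (suc t) z) l′ r) (shift l (+ t))
        (F-front (iter F t z) (front-iter front t))
  where
  shift : ∀ l t → (l - t) - + 1 ≡ l - (+ 1 + t)
  shift = solve-∀

-- At time w + 1 both the front, now at l - w, and the wall at r ≥ l differ from the dead
-- background, so no window of width w can contain the differences.
front⇒unbounded : ∀ x y {b l r} → (∀ j → x j ≡ b) → Front (F y) l r →
  ¬ BoundedDifference x y
front⇒unbounded x y {l = l} {r} x≡b front (w , bounded) =
  ℤP.<-irrefl refl (ℤP.<-≤-trans r<a+w a+w≤r)
  where
  a : ℤ
  a = proj₁ (bounded (w ℕ.+ 1))
  window : ∀ j → iter F (w ℕ.+ 1) x j ≢ iter F (w ℕ.+ 1) y j → a ≤ j × j < a + + w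
  window = proj₂ (bounded (w ℕ.+ 1))
  frontʷ : Front (iter F w (F y)) (l - + w) r
  frontʷ = front-iter front w
  at : ∀ z j → iter F (w ℕ.+ 1) z j ≡ iter F w (F z) j
  at z j = cong (λ z′ → z′ j) (iter-+ F w 1 z)
  x-dead : ∀ j → iter F w (F x) j ≡ false
  x-dead = iter-preserves (λ z → ∀ j → z j ≡ false) (λ z → F-constant z) w (F-constant x x≡b)
  differs : ∀ j → iter F w (F y) j ≡ true → iter F (w ℕ.+ 1) x j ≢ iter F (w ℕ.+ 1) y j
  differs j yj xj≡yj =
    case trans (sym (x-dead j)) (trans (sym (at x j)) (trans xj≡yj (trans (at y j) yj))) of λ ()
  a≤l-w : a ≤ l - + w
  a≤l-w = proj₁ (window (l - + w) (differs (l - + w) (Front.leading frontʷ)))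
  r<a+w : r < a + + w
  r<a+w = proj₂ (window r (differs r (Wall.high (Front.wall frontʷ))))
  cancel : ∀ l w → (l - w) + w ≡ l
  cancel = solve-∀
  a+w≤r : a + + w ≤ r
  a+w≤r = ℤP.≤-trans (ℤP.+-monoˡ-≤ (+ w) a≤l-w)
                     (subst (_≤ r) (sym (cancel l (+ w))) (Front.l≤r front))

F-true-prefix : ∀ z {l} → (∀ j → j < l → z j ≡ true) → z l ≡ false →
  (∀ j → j < left l → F z j ≡ false) × F z (left l) ≡ true
F-true-prefix z {l} ones zl =
  (λ j j<l-1 → F-eval z j (ones (left j) (ℤP.<-trans (left<i j) (ℤP.<-trans j<l-1 (left<i l))))
                          (ones j (ℤP.<-trans j<l-1 (left<i l)))
                          (ones (right j) (ℤP.≤-<-trans (<⇒right≤ j<l-1) (left<i l)))) ,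
  F-eval z (left l) (ones (left (left l)) (ℤP.<-trans (left<i (left l)) (left<i l)))
                    (ones (left l) (left<i l))
                    (trans (cong z (right-left l)) zl)

-- Periodic configurations

-- On negative numbers _%ℕ_ is defined by a with on suc m % d; these are its equations.

-[1+]%ℕ-cong : ∀ {m m′} d .{{_ : NonZero d}} → suc m % d ≡ suc m′ % d →
  -[1+ m ] %ℕ d ≡ -[1+ m′ ] %ℕ d
-[1+]%ℕ-cong {m} {m′} d eq with suc m % d | suc m′ % d | eq
... | r | .r | refl = refl

-[1+]%ℕ≡0 : ∀ {m} d .{{_ : NonZero d}} → suc m % d ≡ 0 → -[1+ m ] %ℕ d ≡ 0
-[1+]%ℕ≡0 {m} d eq with suc m % d | eq
... | .0 | refl = refl

-[1+]%ℕ≡∸ : ∀ {m r} d .{{_ : NonZero d}} → suc m % d ≡ suc r → -[1+ m ] %ℕ d ≡ d ∸ suc r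
-[1+]%ℕ≡∸ {m} d eq with suc m % d | eq
... | ._ | refl = refl

[i+d]%ℕd≡i%ℕd : ∀ i d .{{_ : NonZero d}} → (i + + d) %ℕ d ≡ i %ℕ d
[i+d]%ℕd≡i%ℕd (+ m) d = [m+n]%n≡m%n m d
[i+d]%ℕd≡i%ℕd -[1+ m ] d with ℕP.<-cmp (suc m) d
... | tri< 1+m<d _ _ = begin
  (d ⊖ suc m) %ℕ d  ≡⟨ cong (_%ℕ d) (ℤP.≤-⊖ (ℕP.<⇒≤ 1+m<d)) ⟩
  (d ∸ suc m) % d   ≡⟨ m<n⇒m%n≡m (ℕP.∸-monoʳ-< {o = 0} (s≤s z≤n) (ℕP.<⇒≤ 1+m<d)) ⟩
  d ∸ suc m         ≡⟨ -[1+]%ℕ≡∸ d (m<n⇒m%n≡m 1+m<d) ⟨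
  -[1+ m ] %ℕ d     ∎
  where open ≡-Reasoning
... | tri≈ _ refl _ =
  trans (cong (_%ℕ d) (ℤP.n⊖n≡0 d)) (sym (-[1+]%ℕ≡0 d (n%n≡0 d)))
... | tri> _ _ d<1+m = begin
  (d ⊖ suc m) %ℕ d   ≡⟨ cong (_%ℕ d) (trans (ℤP.⊖-< d<1+m)
                                            (cong (λ n → ℤ.- + n) (ℕP.+-∸-assoc 1 d≤m))) ⟩
  -[1+ m ∸ d ] %ℕ d  ≡⟨ -[1+]%ℕ-cong d (trans (sym ([m+n]%n≡m%n (suc (m ∸ d)) d))
                                              (cong (λ n → suc n % d) (ℕP.m∸n+n≡m d≤m))) ⟩
  -[1+ m ] %ℕ d      ∎
  where
  open ≡-Reasoning
  d≤m : d ℕ.≤ m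
  d≤m = ℕP.≤-pred d<1+m

periodic-shift : ∀ {k} (u : Vec Bool (suc k)) j → periodic u (j + + suc k) ≡ periodic u j
periodic-shift {k} u j = cong (lookup u) (fromℕ<-cong _ _ ([i+d]%ℕd≡i%ℕd j (suc k)) _ _)

periodic-lookup : ∀ {k} (u : Vec Bool (suc k)) (i : Fin (suc k)) →
  periodic u (+ toℕ i) ≡ lookup u i
periodic-lookup u i = cong (lookup u)
  (trans (fromℕ<-cong _ _ (m<n⇒m%n≡m (toℕ<n i)) _ (toℕ<n i)) (fromℕ<-toℕ i (toℕ<n i)))

module _ {z : Config} {k : ℕ} (period : ∀ j → z (j + + suc k) ≡ z j) where

  wall-shift : ∀ (f : ℤ → ℤ) → (∀ j → z (f j) ≡ z j) →
    (∀ j → right (f j) ≡ f (right j)) → ∀ {q} → Wall z q → Wall z (f q)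
  wall-shift f zf≡z f-right {q} (mkWall zq zq′) =
    mkWall (trans (zf≡z q) zq) (trans (cong z (f-right q)) (trans (zf≡z (right q)) zq′))

  wall-up : ∀ {q} → Wall z q → Wall z (q + + suc k)
  wall-up = wall-shift (λ j → j + + suc k) period (λ j → comm j (+ suc k))
    where
    comm : ∀ j a → (j + a) + + 1 ≡ (j + + 1) + a
    comm = solve-∀

  wall-down : ∀ {q} → Wall z q → Wall z (q - + suc k)
  wall-down = wall-shift (λ j → j - + suc k) period⁻ (λ j → comm j (+ suc k))
    where
    cancel : ∀ j a → (j - a) + a ≡ j
    cancel = solve-∀
    period⁻ : ∀ j → z (j - + suc k) ≡ z j
    period⁻ j = trans (sym (period _)) (cong z (cancel j (+ suc k)))
    comm : ∀ j a → (j - a) + + 1 ≡ (j + + 1) - a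
    comm = solve-∀

  walls-above : ∀ d {q} → Wall z q → ∃ λ q′ → Wall z q′ × q + + d ≤ q′
  walls-above zero {q} wall = q , wall , ℤP.≤-reflexive (ℤP.+-identityʳ q)
  walls-above (suc d) {q} wall =
    let q′ , wall′ , q+L+d≤q′ = walls-above d (wall-up wall)
    in  q′ , wall′ , ℤP.≤-trans q+1+d≤q+L+d q+L+d≤q′
    where
    q+1+d≤q+L+d : q + + suc d ≤ (q + + suc k) + + d
    q+1+d≤q+L+d = subst (q + + suc d ≤_) (sym (ℤP.+-assoc q (+ suc k) (+ d)))
                        (ℤP.+-monoʳ-≤ q (+≤+ (s≤s (ℕP.m≤n+m d k))))

  walls-below : ∀ d {q} → Wall z q → ∃ λ q′ → Wall z q′ × q′ ≤ q - + d
  walls-below zero {q} wall = q , wall , ℤP.≤-reflexive (sym (ℤP.+-identityʳ q))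
  walls-below (suc d) {q} wall =
    let q′ , wall′ , q′≤q-L-d = walls-below d (wall-down wall)
    in  q′ , wall′ , ℤP.≤-trans q′≤q-L-d q-L-d≤q-1-d
    where
    assoc : ∀ q a b → (q - a) - b ≡ q - (a + b)
    assoc = solve-∀
    q-L-d≤q-1-d : (q - + suc k) - + d ≤ q - + suc d
    q-L-d≤q-1-d = subst (_≤ q - + suc d) (sym (assoc q (+ suc k) (+ d)))
                        (ℤP.+-monoʳ-≤ q (ℤP.neg-mono-≤ (+≤+ (s≤s (ℕP.m≤n+m d k)))))

periodic-wall : ∀ {k} (u : Vec Bool (suc k)) {i₁ i₀} →
  lookup u i₁ ≡ true → lookup u i₀ ≡ false → ∃ λ m → Wall (periodic u) (+ m)
periodic-wall {k} u {i₁} {i₀} u₁ u₀ =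
  case wall-after (periodic u)
         (+≤+ (ℕP.≤-trans (ℕP.<⇒≤ (toℕ<n i₁)) (ℕP.m≤n+m (suc k) (toℕ i₀))))
         (trans (periodic-lookup u i₁) u₁)
         (trans (periodic-shift u (+ toℕ i₀)) (trans (periodic-lookup u i₀) u₀))
  of λ where
    (+ m , _ , wall) → m , wall
    (-[1+ _ ] , () , _)

patch-below : ∀ {k n} (u : Vec Bool (suc k)) (x : Vec Bool n) j → j ≤ -[1+ 0 ] →
  periodic u j ≡ patch u x j
patch-below u x -[1+ m ] _ = refl
patch-below u x (+ m) ()

patch-beyond : ∀ {k n} (u : Vec Bool (suc k)) (x : Vec Bool n) j → + n ≤ j →
  periodic u j ≡ patch u x j
patch-beyond {n = n} u x (+ m) (+≤+ n≤m) with m ℕ.<? n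
... | yes m<n = ⊥-elim (ℕP.<⇒≱ m<n n≤m)
... | no  _   = refl

patch-lookup : ∀ {k n} (u : Vec Bool (suc k)) (x : Vec Bool n) (i : Fin n) →
  patch u x (+ toℕ i) ≡ lookup x i
patch-lookup {n = n} u x i with toℕ i ℕ.<? n
... | yes i<n = cong (lookup x) (fromℕ<-toℕ i i<n)
... | no  i≮n = ⊥-elim (i≮n (toℕ<n i))

bits⇒sinv : ∀ {k} (u : Vec Bool (suc k)) {i₁ i₀} →
  lookup u i₁ ≡ true → lookup u i₀ ≡ false → ∀ {n} (x : Vec Bool n) → SInv 78 u x
bits⇒sinv u u₁ u₀ {n} x =
  let m , wall = periodic-wall u u₁ u₀
      qL , wallL , qL≤m-2-m = walls-below (periodic-shift u) (2 ℕ.+ m) wall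
      qR , wallR , m+n≤qR = walls-above (periodic-shift u) n wall
  in  sandwich⇒bounded (periodic u) (patch u x) (record
        { wallˡ  = wallL
        ; wallʳ  = wallR
        ; agreeˡ = λ j j≤qL+1 → patch-below u x j (ℤP.≤-trans j≤qL+1
                     (right-mono-≤ (subst (qL ≤_) (far-left (+ m)) qL≤m-2-m)))
        ; agreeʳ = λ j qR≤j → patch-beyond u x j
                     (ℤP.≤-trans (ℤP.≤-trans (+≤+ (ℕP.m≤n+m n m)) m+n≤qR) qR≤j)
        })
  where
  far-left : ∀ i → i - (+ 2 + i) ≡ -[1+ 1 ]
  far-left = solve-∀

nonuniform⇒sinv : ∀ {k} (u : Vec Bool (suc k)) {i i′} → lookup u i ≢ lookup u i′ →
  ∀ {n} (x : Vec Bool n) → SInv 78 u x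
nonuniform⇒sinv u {i} {i′} uᵢ≢uᵢ′ x with lookup u i in eᵢ | lookup u i′ in eᵢ′
... | true  | false = bits⇒sinv u eᵢ eᵢ′ x
... | false | true  = bits⇒sinv u eᵢ′ eᵢ x
... | true  | true  = ⊥-elim (uᵢ≢uᵢ′ refl)
... | false | false = ⊥-elim (uᵢ≢uᵢ′ refl)

-- Constant periodic backgrounds

module _ {k n} (u : Vec Bool (suc k)) {c : Bool} (u≡c : ∀ i → lookup u i ≡ c) (x : Vec Bool n)
  where

  patch-below-uniform : ∀ j → j ≤ -[1+ 0 ] → patch u x j ≡ c
  patch-below-uniform j j≤-1 = trans (sym (patch-below u x j j≤-1)) (u≡c _)

  patch-beyond-uniform : ∀ j → + n ≤ j → patch u x j ≡ c
  patch-beyond-uniform j n≤j = trans (sym (patch-beyond u x j n≤j)) (u≡c _)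

  all⇒sinv : All (_≡ c) x → SInv 78 u x
  all⇒sinv all = 0 , λ t → + 0 , λ j differs → ⊥-elim (differs (iter-cong agree t j))
    where
    agree : ∀ j → periodic u j ≡ patch u x j
    agree -[1+ m ] = refl
    agree (+ m) with m ℕ.<? n
    ... | yes m<n = trans (u≡c _) (sym (lookup⁺ all _))
    ... | no  _   = refl

defect⇒¬sinv : ∀ {k n} (u : Vec Bool (suc k)) c → (∀ i → lookup u i ≡ c) →
  (x : Vec Bool n) (i : Fin n) → lookup x i ≢ c → ¬ SInv 78 u x
defect⇒¬sinv {n = n} u false u≡0 x i xᵢ≢0 =
  let l , l≤i , Yl≢0 , zeros = first-after-prefix Y {q = + toℕ i} (patch-below-uniform u u≡0 x)
                                   -≤+ (xᵢ≢0 ∘ trans (sym (patch-lookup u x i)))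
      _ , front = prefix-front Y {q = + n} zeros (¬-not Yl≢0)
                    (patch-beyond-uniform u u≡0 x (+ n) ℤP.≤-refl)
                    (ℤP.≤-trans l≤i (+≤+ (ℕP.<⇒≤ (toℕ<n i))))
  in  front⇒unbounded (periodic u) Y (λ _ → u≡0 _) (F-front Y front)
  where
  Y : Config
  Y = patch u x
defect⇒¬sinv {n = n} u true u≡1 x i xᵢ≢1 =
  let l , l≤i , Yl≢1 , ones = first-after-prefix Y {q = + toℕ i} (patch-below-uniform u u≡1 x)
                                  -≤+ (xᵢ≢1 ∘ trans (sym (patch-lookup u x i)))
      vacant , leading = F-true-prefix Y ones (¬-not Yl≢1)
      _ , front = prefix-front (F Y) {q = right (+ n)} vacant leading F-beyond
                    (ℤP.≤-trans (ℤP.<⇒≤ (left<i l))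
                                (ℤP.≤-trans l≤i (≤⇒≤right (+≤+ (ℕP.<⇒≤ (toℕ<n i))))))
  in  front⇒unbounded (periodic u) Y (λ _ → u≡1 _) front
  where
  Y : Config
  Y = patch u x
  beyond : ∀ j → + n ≤ j → Y j ≡ true
  beyond = patch-beyond-uniform u u≡1 x
  F-beyond : F Y (right (+ n)) ≡ false
  F-beyond = F-eval Y (right (+ n))
                    (trans (cong Y (left-right (+ n))) (beyond (+ n) ℤP.≤-refl))
                    (beyond (right (+ n)) (i≤right (+ n)))
                    (beyond (right (right (+ n))) (≤⇒≤right (i≤right (+ n))))

sinv⇔all : ∀ {k n} (u : Vec Bool (suc k)) {c} → (∀ i → lookup u i ≡ c) →
  (x : Vec Bool n) → SInv 78 u x ⇔ All (_≡ c) x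
sinv⇔all {n = n} u {c} u≡c x = mk⇔ sinv⇒all (all⇒sinv u u≡c x)
  where
  sinv⇒all : SInv 78 u x → All (_≡ c) x
  sinv⇒all sinv = decidable-stable (allᵥ? (_≟ c) x) λ ¬all →
    let i , xᵢ≢c = ¬∀⟶∃¬ n _ (λ i → lookup x i ≟ c) (¬all ∘ lookup⁻)
    in defect⇒¬sinv u c u≡c x i xᵢ≢c sinv

-- Protocols

conjProtocol : ∀ {X Y : Set} {P : X → Set} {Q : Y → Set} → Decidable P → Decidable Q →
  Protocol X Y Bool
conjProtocol P? Q? = alice (does ∘ P?) (leaf false) (bob (does ∘ Q?) (leaf false) (leaf true))

conjProtocol-computes : ∀ {X Y : Set} {P : X → Set} {Q : Y → Set}
  (P? : Decidable P) (Q? : Decidable Q) → Computes (conjProtocol P? Q?) (λ x y → P x × Q y)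
conjProtocol-computes P? Q? x y with P? x | Q? y
... | no ¬p | _     = (λ ()) , λ (p , _) → ⊥-elim (¬p p)
... | yes p | no ¬q = (λ ()) , λ (_ , q) → ⊥-elim (¬q q)
... | yes p | yes q = (λ _ → p , q) , λ _ → refl

computes-cong : ∀ {X Y : Set} (π : Protocol X Y Bool) {P Q : X → Y → Set} →
  (∀ x y → P x y ⇔ Q x y) → Computes π P → Computes π Q
computes-cong π P⇔Q computes x y =
  Equivalence.to (P⇔Q x y) ∘ proj₁ (computes x y) ,
  proj₂ (computes x y) ∘ Equivalence.from (P⇔Q x y)

proposition8 : ∀ (k : ℕ) (u : Vec Bool (suc k)) →
  ∃ λ (C : ℕ) → ∃ λ (N : ℕ) → ∀ (i j : ℕ) → N ℕ.≤ i ℕ.+ j →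
    Σ (Protocol (Vec Bool i) (Vec Bool j) Bool) λ π →
      (depth π ℕ.≤ C) × Computes π (λ x y → SInv 78 u (x ++ y))
proposition8 k u with all? (λ i → lookup u i ≟ lookup u zero)
... | yes uniform = 2 , 0 , λ _ _ _ →
      π , ℕP.≤-refl , computes-cong π halves (conjProtocol-computes all-c? all-c?)
  where
  c : Bool
  c = lookup u zero
  all-c? : ∀ {m} → Decidable (λ (v : Vec Bool m) → All (_≡ c) v)
  all-c? = allᵥ? (_≟ c)
  π : ∀ {i j} → Protocol (Vec Bool i) (Vec Bool j) Bool
  π = conjProtocol all-c? all-c?
  halves : ∀ {i j} (x : Vec Bool i) (y : Vec Bool j) →
    (All (_≡ c) x × All (_≡ c) y) ⇔ SInv 78 u (x ++ y)
  halves x y = mk⇔ (Equivalence.from (sinv⇔all u uniform (x ++ y)) ∘ uncurry ++⁺)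
                   (++⁻ x ∘ Equivalence.to (sinv⇔all u uniform (x ++ y)))
... | no nonuniform = 0 , 0 , λ _ _ _ →
      leaf true , z≤n ,
      λ x y → (λ _ → nonuniform⇒sinv u (proj₂ witness) (x ++ y)) , λ _ → refl
  where
  witness : ∃ λ i → lookup u i ≢ lookup u zero
  witness = ¬∀⟶∃¬ (suc k) _ (λ i → lookup u i ≟ lookup u zero) nonuniform
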